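{- Let $G=(V,E)$ be a VC-irreducible graph, let $U\subseteq V$ be a VC-one-overlap of $G$, and let $u\notin V$ be a new vertex. Then $\Gamma(G,U,u)=(V\cup\{u\},E\cup\{\{u,v\}: v\in U\})$ is VC-irreducible.
   Context: Graphs are finite, simple, undirected. A vertex cover is a set of vertices meeting every edge. A connected graph $G=(V,E)$ is VC-irreducible if for every edge $e\in E$ the graph $(V,E\setminus\{e\})$ has strictly smaller minimum vertex cover size than $G$. For a connected graph $G=(V,E)$, a set $U\subseteq V$ is a VC-overlap if $U\not\subseteq C$ for every minimum vertex cover $C$ of $G$. A VC-overlap $U$ is a VC-one-overlap if additionally for every $w\in U$ there exists a minimum vertex cover $C_w$ of $G$ with $w\notin C_w$ and $U\setminus\{w\}\subseteq C_w$. -}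

module Defs where

open import Data.Nat using (ℕ; suc; _≤_; _<_)
open import Data.Bool using (Bool; true; false; _∧_; _∨_; not)
open import Data.Fin using (Fin; zero; suc; _≟_)
open import Data.Fin.Subset using (Subset; _∈_; _⊆_; ∣_∣)
open import Data.Vec using (lookup)
open import Data.Product using (Σ; _×_; _,_)
open import Data.Sum using (_⊎_)
open import Relation.Nullary using (¬_; ⌊_⌋)
open import Relation.Binary.PropositionalEquality using (_≡_; _≢_)

record Graph (n : ℕ) : Set where
  field
    adj    : Fin n → Fin n → Bool
    sym    : ∀ i j → adj i j ≡ adj j i
    irrefl : ∀ i → adj i i ≡ false
open Graph public

data Reach {n : ℕ} (G : Graph n) : Fin n → Fin n → Set where
  here : ∀ {i} → Reach G i i
  step : ∀ {i j k} → adj G i j ≡ true → Reach G j k → Reach G i k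

Connected : {n : ℕ} → Graph n → Set
Connected G = ∀ i j → Reach G i j

IsVC : {n : ℕ} → Graph n → Subset n → Set
IsVC G C = ∀ i j → adj G i j ≡ true → i ∈ C ⊎ j ∈ C

IsMinVC : {n : ℕ} → Graph n → Subset n → Set
IsMinVC G C = IsVC G C × (∀ D → IsVC G D → ∣ C ∣ ≤ ∣ D ∣)

TauLess : {n : ℕ} → Graph n → Graph n → Set
TauLess H G = Σ _ λ D → IsVC H D × (∀ C → IsVC G C → ∣ D ∣ < ∣ C ∣)

removeEdge : {n : ℕ} → Graph n → Fin n → Fin n → Graph n
removeEdge {n} G a b = record { adj = A ; sym = S ; irrefl = I }
  where
  hit : Fin n → Fin n → Bool
  hit i j = (⌊ i ≟ a ⌋ ∧ ⌊ j ≟ b ⌋) ∨ (⌊ i ≟ b ⌋ ∧ ⌊ j ≟ a ⌋)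
  A : Fin n → Fin n → Bool
  A i j = adj G i j ∧ not (hit i j)
  hitSym : ∀ i j → hit i j ≡ hit j i
  hitSym i j with ⌊ i ≟ a ⌋ | ⌊ j ≟ b ⌋ | ⌊ i ≟ b ⌋ | ⌊ j ≟ a ⌋
  ... | false | false | false | false = _≡_.refl
  ... | false | false | false | true  = _≡_.refl
  ... | false | false | true  | false = _≡_.refl
  ... | false | false | true  | true  = _≡_.refl
  ... | false | true  | false | false = _≡_.refl
  ... | false | true  | false | true  = _≡_.refl
  ... | false | true  | true  | false = _≡_.refl
  ... | false | true  | true  | true  = _≡_.refl
  ... | true  | false | false | false = _≡_.refl
  ... | true  | false | false | true  = _≡_.refl
  ... | true  | false | true  | false = _≡_.refl
  ... | true  | false | true  | true  = _≡_.refl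
  ... | true  | true  | false | false = _≡_.refl
  ... | true  | true  | false | true  = _≡_.refl
  ... | true  | true  | true  | false = _≡_.refl
  ... | true  | true  | true  | true  = _≡_.refl
  S : ∀ i j → A i j ≡ A j i
  S i j rewrite sym G i j | hitSym i j = _≡_.refl
  I : ∀ i → A i i ≡ false
  I i rewrite irrefl G i = _≡_.refl

VCIrreducible : {n : ℕ} → Graph n → Set
VCIrreducible G =
  Connected G × (∀ a b → adj G a b ≡ true → TauLess (removeEdge G a b) G)

VCOverlap : {n : ℕ} → Graph n → Subset n → Set
VCOverlap G U = ∀ C → IsMinVC G C → ¬ (U ⊆ C)

VCOneOverlap : {n : ℕ} → Graph n → Subset n → Set
VCOneOverlap G U =
  VCOverlap G U ×
  (∀ w → w ∈ U → Σ _ λ Cw → IsMinVC G Cw × ¬ (w ∈ Cw) ×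
      (∀ x → x ∈ U → x ≢ w → x ∈ Cw))

-- Γ(G,U,u): new vertex u = zero, old vertex v = suc v, u adjacent to exactly U.
Γ : {n : ℕ} → Graph n → Subset n → Graph (suc n)
Γ {n} G U = record { adj = A ; sym = S ; irrefl = I }
  where
  A : Fin (suc n) → Fin (suc n) → Bool
  A zero    zero    = false
  A zero    (suc v) = lookup U v
  A (suc v) zero    = lookup U v
  A (suc i) (suc j) = adj G i j
  S : ∀ i j → A i j ≡ A j i
  S zero    zero    = _≡_.refl
  S zero    (suc v) = _≡_.refl
  S (suc v) zero    = _≡_.refl
  S (suc i) (suc j) = sym G i j
  I : ∀ i → A i i ≡ false
  I zero    = _≡_.refl
  I (suc i) = irrefl G i

module Submission where

-- Every vertex cover of Γ(G,U,u) has more than τ(G) vertices: one containing u restricts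
-- to a cover of G, and one avoiding u must contain U, so it cannot be a minimum cover of G.
-- Hence removing an edge of G from Γ lowers τ (add u to a small cover of G − e), and
-- removing an edge {u,w} lowers τ as well, since a minimum cover C_w ⊇ U ∖ {w} of G
-- already covers Γ − {u,w}.

open import Defs
open import Data.Nat using (ℕ; zero; suc; _≤_; _<_; s≤s)
open import Data.Nat.Properties using (≤-trans; ≤-<-trans; ≤-refl; ≤-pred; ≰⇒>; ≮⇒≥; _<?_)
open import Data.Bool using (true; false; _∧_; _∨_; not)
open import Data.Bool.Properties using () renaming (_≟_ to _≟ᵇ_)
open import Data.Fin using (Fin; zero; suc; _≟_)
open import Data.Fin.Properties using (all?)
open import Data.Fin.Subset using (Subset; _∈_; _⊆_; ∣_∣; inside; outside; ⊤; Nonempty)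
open import Data.Fin.Subset.Properties using (_∈?_; anySubset?; ∈⊤; nonempty?)
open import Data.Vec using (_∷_)
open import Data.Vec.Properties using (lookup⇒[]=; []=⇒lookup)
open import Data.Vec.Base using (_[_]=_)
open _[_]=_
open import Data.Product as Prod using (Σ; _×_; _,_; proj₂)
open import Data.Sum as Sum using (_⊎_; inj₁; inj₂)
open import Function using (_∘_)
open import Relation.Nullary using (¬_; Dec; yes; no; does; contradiction)
open import Relation.Nullary.Decidable using (isYes≗does; dec-false; _→-dec_; _⊎-dec_; _×-dec_)
open import Relation.Binary.PropositionalEquality as ≡ using (_≡_; refl; cong; cong₂; trans; _≢_)

private variable
  n : ℕ

module _ {p} {P : Set p} where

  ∧-not-does⁻ : ∀ x (p? : Dec P) → x ∧ not (does p?) ≡ true → x ≡ true × ¬ P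
  ∧-not-does⁻ true  (no ¬p) refl = refl , ¬p
  ∧-not-does⁻ true  (yes _) ()
  ∧-not-does⁻ false _       ()

  ∧-not-does⁺ : ∀ {x} (p? : Dec P) → x ≡ true → ¬ P → x ∧ not (does p?) ≡ true
  ∧-not-does⁺ p? refl ¬p rewrite dec-false p? ¬p = refl

SameEdge : (a b i j : Fin n) → Set
SameEdge a b i j = (i ≡ a × j ≡ b) ⊎ (i ≡ b × j ≡ a)

sameEdge? : (a b i j : Fin n) → Dec (SameEdge a b i j)
sameEdge? a b i j = (i ≟ a ×-dec j ≟ b) ⊎-dec (i ≟ b ×-dec j ≟ a)

module _ {a b i j : Fin n} where

  SameEdge-sym : SameEdge a b i j → SameEdge i j a b
  SameEdge-sym (inj₁ (refl , refl)) = inj₁ (refl , refl)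
  SameEdge-sym (inj₂ (refl , refl)) = inj₂ (refl , refl)

  SameEdge-swap : SameEdge a b i j → SameEdge a b j i
  SameEdge-swap = Sum.swap ∘ Sum.map Prod.swap Prod.swap

  SameEdge-suc : SameEdge a b i j → SameEdge (suc a) (suc b) (suc i) (suc j)
  SameEdge-suc = Sum.map (Prod.map (cong suc) (cong suc)) (Prod.map (cong suc) (cong suc))

module _ (H : Graph n) (a b i j : Fin n) where

  removeEdge-adj : adj (removeEdge H a b) i j ≡ adj H i j ∧ not (does (sameEdge? a b i j))
  removeEdge-adj = cong (λ hit → adj H i j ∧ not hit)
    (cong₂ _∨_ (cong₂ _∧_ (isYes≗does (i ≟ a)) (isYes≗does (j ≟ b)))
               (cong₂ _∧_ (isYes≗does (i ≟ b)) (isYes≗does (j ≟ a))))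

  removeEdge-adj⁻ : adj (removeEdge H a b) i j ≡ true →
                    adj H i j ≡ true × ¬ SameEdge a b i j
  removeEdge-adj⁻ e =
    ∧-not-does⁻ (adj H i j) (sameEdge? a b i j) (trans (≡.sym removeEdge-adj) e)

  removeEdge-adj⁺ : adj H i j ≡ true → ¬ SameEdge a b i j →
                    adj (removeEdge H a b) i j ≡ true
  removeEdge-adj⁺ ij ¬same =
    trans removeEdge-adj (∧-not-does⁺ (sameEdge? a b i j) ij ¬same)

Reach-trans : {G : Graph n} {i j k : Fin n} → Reach G i j → Reach G j k → Reach G i k
Reach-trans here       r = r
Reach-trans (step e q) r = step e (Reach-trans q r)

module _ (G : Graph n) where

  isVC? : ∀ C → Dec (IsVC G C)
  isVC? C = all? λ i → all? λ j → (adj G i j ≟ᵇ true) →-dec (i ∈? C ⊎-dec j ∈? C)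

  -- Descend to ever smaller covers; k bounds the length of the descent.
  minVC-below : ∀ k D → IsVC G D → ∣ D ∣ ≤ k → Σ _ (IsMinVC G)
  minVC-below k D vcD _ with anySubset? (λ E → isVC? E ×-dec ∣ E ∣ <? ∣ D ∣)
  ... | no ¬smaller = D , vcD , λ E vcE → ≮⇒≥ (λ E<D → ¬smaller (E , vcE , E<D))
  minVC-below zero D vcD D≤0 | yes (E , vcE , E<D) with ≤-trans E<D D≤0
  ... | ()
  minVC-below (suc k) D vcD D≤k | yes (E , vcE , E<D) =
    minVC-below k E vcE (≤-pred (≤-trans E<D D≤k))

  minVC : Σ _ (IsMinVC G)
  minVC = minVC-below _ ⊤ (λ i j _ → inj₁ ∈⊤) ≤-refl

module _ (G : Graph n) (U : Subset n) where

  Γ-adj-new : ∀ {w} → adj (Γ G U) zero (suc w) ≡ true → w ∈ U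
  Γ-adj-new {w} = lookup⇒[]= w U

  Γ-reach-suc : ∀ {i j} → Reach G i j → Reach (Γ G U) (suc i) (suc j)
  Γ-reach-suc here       = here
  Γ-reach-suc (step e r) = step e (Γ-reach-suc r)

  Γ-connected : Connected G → Nonempty U → Connected (Γ G U)
  Γ-connected conn (w , w∈U) = connΓ
    where
    uw : adj (Γ G U) zero (suc w) ≡ true
    uw = []=⇒lookup w∈U
    connΓ : Connected (Γ G U)
    connΓ zero    zero    = here
    connΓ zero    (suc j) = step uw (Γ-reach-suc (conn w j))
    connΓ (suc i) zero    = Reach-trans (Γ-reach-suc (conn i w)) (step uw here)
    connΓ (suc i) (suc j) = Γ-reach-suc (conn i j)

  Γ-cover-restrict : ∀ {c C} → IsVC (Γ G U) (c ∷ C) → IsVC G C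
  Γ-cover-restrict vc i j e with vc (suc i) (suc j) e
  ... | inj₁ (there i∈C) = inj₁ i∈C
  ... | inj₂ (there j∈C) = inj₂ j∈C

  Γ-cover-outside⇒⊆ : ∀ {C} → IsVC (Γ G U) (outside ∷ C) → U ⊆ C
  Γ-cover-outside⇒⊆ vc {x} x∈U with vc zero (suc x) ([]=⇒lookup x∈U)
  ... | inj₂ (there x∈C) = x∈C

  minVC<Γ-cover : VCOverlap G U → ∀ {M} → IsMinVC G M →
                  ∀ C → IsVC (Γ G U) C → ∣ M ∣ < ∣ C ∣
  minVC<Γ-cover ov (_ , minM) (inside ∷ C) vc = s≤s (minM C (Γ-cover-restrict vc))
  minVC<Γ-cover ov (_ , minM) (outside ∷ C) vc =
    ≰⇒> λ C≤M → ov C (Γ-cover-restrict vc , λ D vcD → ≤-trans C≤M (minM D vcD))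
                     (Γ-cover-outside⇒⊆ vc)

  overlap⇒nonempty : VCOverlap G U → Nonempty U
  overlap⇒nonempty ov with nonempty? U
  ... | yes ne = ne
  ... | no ¬ne = contradiction (λ {x} x∈U → contradiction (x , x∈U) ¬ne) (ov _ (proj₂ (minVC G)))

  Γ-old-edge-cover : ∀ {D} a b → IsVC (removeEdge G a b) D →
                     IsVC (removeEdge (Γ G U) (suc a) (suc b)) (inside ∷ D)
  Γ-old-edge-cover a b vcD zero    j       _ = inj₁ here
  Γ-old-edge-cover a b vcD (suc x) zero    _ = inj₂ here
  Γ-old-edge-cover a b vcD (suc x) (suc y) e
    with removeEdge-adj⁻ (Γ G U) (suc a) (suc b) (suc x) (suc y) e
  ... | xy , ¬same =
    Sum.map there there (vcD x y (removeEdge-adj⁺ G a b x y xy (¬same ∘ SameEdge-suc)))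

  Γ-new-edge-cover : ∀ {w C} a b → SameEdge zero (suc w) a b → IsVC G C →
                     (∀ x → x ∈ U → x ≢ w → x ∈ C) →
                     IsVC (removeEdge (Γ G U) a b) (outside ∷ C)
  Γ-new-edge-cover a b ab vcC U-w⊆C i j e with removeEdge-adj⁻ (Γ G U) a b i j e
  Γ-new-edge-cover _ _ ab vcC U-w⊆C zero    zero    _ | () , _
  Γ-new-edge-cover _ _ ab vcC U-w⊆C zero    (suc x) _ | x∈U , ¬same =
    inj₂ (there (U-w⊆C x (Γ-adj-new x∈U) λ { refl → ¬same (SameEdge-sym ab) }))
  Γ-new-edge-cover _ _ ab vcC U-w⊆C (suc x) zero    _ | x∈U , ¬same =
    inj₁ (there (U-w⊆C x (Γ-adj-new x∈U) λ { refl → ¬same (SameEdge-swap (SameEdge-sym ab)) }))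
  Γ-new-edge-cover _ _ ab vcC U-w⊆C (suc x) (suc y) _ | xy , _ =
    Sum.map there there (vcC x y xy)

  Γ-old-edge-TauLess : VCOverlap G U → ∀ a b → TauLess (removeEdge G a b) G →
                       TauLess (removeEdge (Γ G U) (suc a) (suc b)) (Γ G U)
  Γ-old-edge-TauLess ov a b (D , vcD , D<) with minVC G
  ... | M , minM@(vcM , _) =
    inside ∷ D , Γ-old-edge-cover a b vcD ,
    λ C vc → ≤-<-trans (D< M vcM) (minVC<Γ-cover ov minM C vc)

  Γ-new-edge-TauLess : VCOneOverlap G U → ∀ {w} a b → w ∈ U → SameEdge zero (suc w) a b →
                       TauLess (removeEdge (Γ G U) a b) (Γ G U)
  Γ-new-edge-TauLess (ov , one) a b w∈U ab with one _ w∈U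
  ... | Cw , minCw@(vcCw , _) , _ , U-w⊆Cw =
    outside ∷ Cw , Γ-new-edge-cover a b ab vcCw U-w⊆Cw , minVC<Γ-cover ov minCw

theorem7 : {n : ℕ} (G : Graph n) (U : Subset n) →
    VCIrreducible G → VCOneOverlap G U → VCIrreducible (Γ G U)
theorem7 G U (conn , irr) oneOverlap@(ov , _) =
  Γ-connected G U conn (overlap⇒nonempty G U ov) , irreducible
  where
  irreducible : ∀ a b → adj (Γ G U) a b ≡ true → TauLess (removeEdge (Γ G U) a b) (Γ G U)
  irreducible zero    zero    ()
  irreducible zero    (suc w) e =
    Γ-new-edge-TauLess G U oneOverlap zero (suc w) (Γ-adj-new G U e) (inj₁ (refl , refl))
  irreducible (suc w) zero    e =
    Γ-new-edge-TauLess G U oneOverlap (suc w) zero (Γ-adj-new G U e) (inj₂ (refl , refl))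
  irreducible (suc a) (suc b) e = Γ-old-edge-TauLess G U ov a b (irr a b e)
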